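{- Let $\mathcal G$ be a graph class of bounded shrub-depth. If there exist integers $d,m,r$ such that every graph $G\in\mathcal G$ has a tree-model of $m$ colours and depth $d$ whose underlying rooted tree does not contain $\overline T_d^{\,r}$ as a rooted subtree, then the copying shrub-depth of $\mathcal G$ is at most $d-1$.
   Context: All graphs are finite, simple and undirected. A tree-model of $m$ colours and depth $d$ of a graph $G$ is a rooted tree $T$ with a set $S\subseteq\{1,\dots,m\}^2\times\{1,\dots,d\}$ such that: every root-to-leaf path has length exactly $d$; the leaves are exactly $V(G)$; each leaf gets one of colours $1,\dots,m$; $(i,j,\ell)\in S$ iff $(j,i,\ell)\in S$; and for distinct $u,v\in V(G)$ coloured $i,j$ at distance $2\ell$ in $T$, $uv\in E(G)$ iff $(i,j,\ell)\in S$. $\mathrm{TM}_d^m$ is the class of such graphs; a class has bounded shrub-depth if it is contained in some $\mathrm{TM}_d^m$. A graph has a $k$-copied tree-model of $m$ colours and depth $d$ if it has a tree-model of $m$ colours and depth $d+1$ in which every node at distance $d$ from the root has at most $k$ leaf descendants; $\mathrm{TMC}_d^{m,k}$ is the class of such graphs, and a class has copying shrub-depth at most $d$ if it is contained in $\mathrm{TMC}_d^{m,k}$ for some $m,k$. $\overline T_d^{\,r}$ denotes the complete rooted $r$-ary tree of height $d$. A rooted tree $U$ contains $\overline T_d^{\,r}$ as a rooted subtree if $U$ has a subtree containing the root of $U$ that is isomorphic to $\overline T_d^{\,r}$ by an isomorphism mapping root to root. -}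

module Defs where

open import Data.Nat using (ℕ; zero; suc; _*_; _≤_)
open import Data.Fin using (Fin)
open import Data.Bool using (Bool; true)
open import Data.List using (List; [_]; concat; tabulate; allFin; length)
open import Data.List.Membership.Propositional using (_∈_)
open import Data.List.Relation.Binary.Permutation.Propositional using (_↭_)
open import Data.Product using (Σ; ∃; ∃-syntax; _×_)
open import Data.Unit using (⊤)
open import Data.Empty using (⊥)
open import Function using (Injective)
open import Relation.Binary.PropositionalEquality using (_≡_; _≢_)
open import Relation.Nullary using (¬_)

record Graph : Set where
  field
    n      : ℕ
    adj    : Fin n → Fin n → Bool
    sym    : ∀ u v → adj u v ≡ adj v u
    irrefl : ∀ v → adj v v ≡ Data.Bool.false
open Graph public

GraphClass : Set₁
GraphClass = Graph → Set

-- Internal nodes have ≥ 1 child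
-- (children indexed by Fin (suc k)), so leaves occur only at depth d.
data RTree (A : Set) : ℕ → Set where
  leaf : A → RTree A zero
  node : ∀ {d} (k : ℕ) → (Fin (suc k) → RTree A d) → RTree A (suc d)

module _ {A : Set} where

  leaves : ∀ {d} → RTree A d → List A
  leaves (leaf a)   = [ a ]
  leaves (node k f) = concat (tabulate (λ i → leaves (f i)))

  -- LeafDist T a b δ : the leaves labelled a and b lie in different
  -- subtrees below their lowest common ancestor, which has height ℓ,
  -- so their distance in T is δ = 2ℓ.
  data LeafDist : ∀ {d} → RTree A d → A → A → ℕ → Set where
    down  : ∀ {d k} {f : Fin (suc k) → RTree A d} (i : Fin (suc k)) {a b δ} →
            LeafDist (f i) a b δ → LeafDist (node k f) a b δ
    split : ∀ {d k} {f : Fin (suc k) → RTree A d} (i j : Fin (suc k)) {a b} →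
            i ≢ j → a ∈ leaves (f i) → b ∈ leaves (f j) →
            LeafDist (node k f) a b (2 * suc d)

  -- ContainsComplete T h r : T contains the complete rooted r-ary tree of
  -- height h as a rooted subtree (root mapped to root).
  ContainsComplete : ∀ {d} → RTree A d → ℕ → ℕ → Set
  ContainsComplete t          zero    r = ⊤
  ContainsComplete (leaf a)   (suc h) r = ⊥
  ContainsComplete (node k f) (suc h) r =
    Σ (Fin r → Fin (suc k)) λ g → Injective _≡_ _≡_ g × (∀ i → ContainsComplete (f (g i)) h r)

  -- every node at height 1 (i.e. at distance d from the root in a tree of
  -- depth d+1) has at most k leaf descendants
  BottomBounded : ∀ {d} → ℕ → RTree A d → Set
  BottomBounded c (leaf a)             = ⊤
  BottomBounded c (node {zero} k f)    = length (leaves (node k f)) ≤ c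
  BottomBounded c (node {suc d} k f)   = ∀ i → BottomBounded c (f i)

-- Tree-model of m colours and depth d of G.
-- S is encoded as a Bool-valued function; only ℓ ∈ {1..d} is ever used.
record TreeModel (G : Graph) (m d : ℕ) : Set where
  field
    tree     : RTree (Fin (n G)) d
    leavesOK : leaves tree ↭ allFin (n G)
    col      : Fin (n G) → Fin m
    S        : Fin m → Fin m → ℕ → Bool
    S-sym    : ∀ i j ℓ → S i j ℓ ≡ S j i ℓ
    edges    : ∀ u v ℓ → u ≢ v → LeafDist tree u v (2 * ℓ) →
               adj G u v ≡ S (col u) (col v) ℓ
open TreeModel public

InTM : ℕ → ℕ → Graph → Set
InTM d m G = TreeModel G m d

InTMC : ℕ → ℕ → ℕ → Graph → Set
InTMC d m k G = Σ (TreeModel G m (suc d)) λ M → BottomBounded k (tree M)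

BoundedShrubDepth : GraphClass → Set
BoundedShrubDepth 𝒢 = ∃[ d ] ∃[ m ] (∀ G → 𝒢 G → InTM d m G)

CopyingShrubDepth≤ : GraphClass → ℕ → Set
CopyingShrubDepth≤ 𝒢 d = ∃[ m ] ∃[ k ] (∀ G → 𝒢 G → InTMC d m k G)

-- Let t be such a tree (depth d ≥ 1).  We reshape t into a tree t′ of the same depth in
-- which every node of height 1 has at most r + 1 leaves, and tag every leaf with one of
-- tagCount r d tags, so that the height at which two leaves meet in t is a function (oldHeight)
-- of their tags and of the height at which they meet in t′.  Then (colour, tag) pairs colour a
-- (r + 1)-copied tree-model of the same graph on t′, reading adjacency back through oldHeight.
--
-- The reshaping is built bottom-up.  At a node of height h + 2 call a child big if it contains
-- the complete r-ary tree of height h + 1.  Fewer than r children are big, so they receive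
-- distinct labels in Fin r.  A big child is pushed one level down (lift), so that its own
-- children hang from the node and its leaves are tagged by its label; a small child is reshaped
-- recursively and kept as one child (wrap).  Finally the roots of these pieces are merged.

module Submission where

open import Defs hiding (sym)
open import Data.Nat using (ℕ; zero; suc; _+_; _*_; _∸_; _≤_; pred; _≟_; s≤s; z≤n)
open import Data.Nat.Properties using (≤-refl; m≤n⇒m≤1+n; 1+n≰n; *-cancelˡ-≡)
open import Data.Fin using (Fin; zero; suc; inject₁; splitAt; join; _↑ˡ_; _↑ʳ_; combine; remQuot)
open import Data.Fin.Properties
  using (suc-injective; inject₁-injective; injective⇒≤; join-splitAt; splitAt-↑ˡ; splitAt-↑ʳ;
         remQuot-combine)
  renaming (_≟_ to _≟ᶠ_)
open import Data.Bool using (Bool; _∧_)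
open import Data.Bool.Properties using (∧-comm; ∧-idem)
open import Data.List using (List; _∷_; _++_; concat; tabulate; map; length; allFin)
open import Data.List.Properties
  using (tabulate-cong; map-tabulate; concat-map; concat-++; ++-identityʳ; length-map; map-∘; map-id)
open import Data.List.Membership.Propositional using (_∈_)
open import Data.List.Membership.Propositional.Properties
  using (∈-concat⁺′; ∈-concat⁻′; ∈-tabulate⁺; ∈-tabulate⁻; ∈-map⁺; ∈-map⁻; ∈-allFin)
open import Data.List.Relation.Unary.Any using (here; there)
open import Data.List.Relation.Unary.All using () renaming (lookup to All-lookup)
open import Data.List.Relation.Unary.AllPairs using (_∷_)
open import Data.List.Relation.Unary.Unique.Propositional using (Unique)
open import Data.List.Relation.Unary.Unique.Propositional.Properties using (allFin⁺)
open import Data.List.Relation.Binary.Permutation.Propositional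
  using (_↭_; ↭-refl; ↭-sym; ↭-trans; ↭-reflexive; ↭⇒↭ₛ; module PermutationReasoning)
open import Data.List.Relation.Binary.Permutation.Propositional.Properties using (++⁺; ∈-resp-↭)
import Data.List.Relation.Binary.Permutation.Setoid.Properties as SetoidPermutation
open import Data.Product using (Σ; ∃; ∃₂; _×_; _,_; proj₁; proj₂)
import Data.Product as Product
open import Data.Sum using (_⊎_; inj₁; inj₂; [_,_]′)
import Data.Sum as Sum
open import Data.Unit using (⊤; tt)
open import Data.Empty using (⊥-elim)
open import Function using (Injective; _∘_; id)
open import Relation.Nullary using (¬_; Dec; yes; no)
open import Relation.Unary using (Decidable)
open import Relation.Binary.PropositionalEquality
  using (_≡_; _≢_; refl; sym; trans; cong; cong₂; subst; setoid; module ≡-Reasoning)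


-- Counting the big children of a node

-- r distinct indices, all satisfying P.  ContainsComplete (node k f) (suc h) r is, by
-- definition, an injective family of r children each containing the complete tree of height h.
InjectiveFamily : ∀ {n} → (Fin n → Set) → ℕ → Set
InjectiveFamily {n} P r = Σ (Fin r → Fin n) λ g → Injective _≡_ _≡_ g × (∀ i → P (g i))

-- Distinct labels in Fin s for all indices satisfying P (so there are at most s of them).
record Labelling {n} (P : Fin n → Set) (s : ℕ) : Set where
  field
    label     : ∀ j → P j → Fin s
    label-inj : ∀ {j j′} (p : P j) (p′ : P j′) → label j p ≡ label j′ p′ → j ≡ j′

empty-family : ∀ {n} {P : Fin n → Set} → InjectiveFamily P 0
empty-family = (λ ()) , (λ { {()} }) , (λ ())

module _ {n} {P : Fin (suc n) → Set} where

  shift-family : ∀ {r} → InjectiveFamily (P ∘ suc) r → InjectiveFamily P r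
  shift-family (g , g-inj , pg) = suc ∘ g , g-inj ∘ suc-injective , pg

  cons-family : ∀ {r} → P zero → InjectiveFamily (P ∘ suc) r → InjectiveFamily P (suc r)
  cons-family {r} p₀ (g , g-inj , pg) = g′ , g′-inj , pg′
    where
    g′ : Fin (suc r) → Fin (suc n)
    g′ zero    = zero
    g′ (suc i) = suc (g i)
    g′-inj : Injective _≡_ _≡_ g′
    g′-inj {zero}  {zero}  _ = refl
    g′-inj {suc i} {suc j} e = cong suc (g-inj (suc-injective e))
    pg′ : ∀ i → P (g′ i)
    pg′ zero    = p₀
    pg′ (suc i) = pg i

  skip-labelling : ∀ {s} → ¬ P zero → Labelling (P ∘ suc) s → Labelling P s
  skip-labelling {s} ¬p₀ L = record { label = label′ ; label-inj = label′-inj }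
    where
    open Labelling L
    label′ : ∀ j → P j → Fin s
    label′ zero    p = ⊥-elim (¬p₀ p)
    label′ (suc j) p = label j p
    label′-inj : ∀ {j j′} (p : P j) (p′ : P j′) → label′ j p ≡ label′ j′ p′ → j ≡ j′
    label′-inj {zero}                p _  _ = ⊥-elim (¬p₀ p)
    label′-inj {suc _} {zero}        _ p′ _ = ⊥-elim (¬p₀ p′)
    label′-inj {suc _} {suc _}       p p′ e = cong suc (label-inj p p′ e)

  cons-labelling : ∀ {s} → Labelling (P ∘ suc) s → Labelling P (suc s)
  cons-labelling {s} L = record { label = label′ ; label-inj = label′-inj }
    where
    open Labelling L
    label′ : ∀ j → P j → Fin (suc s)
    label′ zero    _ = zero
    label′ (suc j) p = suc (label j p)
    label′-inj : ∀ {j j′} (p : P j) (p′ : P j′) → label′ j p ≡ label′ j′ p′ → j ≡ j′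
    label′-inj {zero}  {zero}  _ _  _ = refl
    label′-inj {suc _} {suc _} p p′ e = cong suc (label-inj p p′ (suc-injective e))

family-or-labelling : ∀ {n} (P : Fin n → Set) → Decidable P → ∀ s →
                      InjectiveFamily P (suc s) ⊎ Labelling P s
family-or-labelling {zero} P P? s = inj₂ (record { label = λ () ; label-inj = λ { {()} } })
family-or-labelling {suc n} P P? s with P? zero
... | no ¬p₀ =
  Sum.map (shift-family {P = P}) (skip-labelling ¬p₀) (family-or-labelling (P ∘ suc) (P? ∘ suc) s)
family-or-labelling {suc n} P P? zero     | yes p₀ =
  inj₁ (cons-family {P = P} p₀ (empty-family {P = P ∘ suc}))
family-or-labelling {suc n} P P? (suc s′) | yes p₀ =
  Sum.map (cons-family {P = P} p₀) cons-labelling (family-or-labelling (P ∘ suc) (P? ∘ suc) s′)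

labelling⇒no-family : ∀ {n s} {P : Fin n → Set} → Labelling P s → ¬ InjectiveFamily P (suc s)
labelling⇒no-family L (g , g-inj , pg) =
  1+n≰n (injective⇒≤ {f = λ i → label (g i) (pg i)} (λ e → g-inj (label-inj (pg _) (pg _) e)))
  where open Labelling L

family? : ∀ {n} (P : Fin n → Set) → Decidable P → ∀ r → Dec (InjectiveFamily P r)
family? P P? zero    = yes (empty-family {P = P})
family? P P? (suc s) with family-or-labelling P P? s
... | inj₁ F = yes F
... | inj₂ L = no (labelling⇒no-family L)

no-family⇒labelling : ∀ {n} (P : Fin n → Set) → Decidable P → ∀ r →
                      ¬ InjectiveFamily P r → Labelling P r
no-family⇒labelling P P? zero    ¬F = ⊥-elim (¬F (empty-family {P = P}))
no-family⇒labelling P P? (suc s) ¬F with family-or-labelling P P? s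
... | inj₁ F = ⊥-elim (¬F F)
... | inj₂ L = record { label     = λ j p → inject₁ (label j p)
                      ; label-inj = λ p p′ e → label-inj p p′ (inject₁-injective e) }
  where open Labelling L

-- Containing a complete r-ary tree is decidable; needed to tell big children from small ones.
contains? : ∀ {A h} (t : RTree A h) h′ r → Dec (ContainsComplete t h′ r)
contains? t          zero     r = yes tt
contains? (leaf a)   (suc h′) r = no (λ ())
contains? (node k f) (suc h′) r = family? _ (λ j → contains? (f j) h′ r) r

few-children : ∀ {A k r} (f : Fin (suc k) → RTree A 0) →
               ¬ ContainsComplete (node k f) 1 r → suc k ≤ r
few-children {r = r} f ¬C = injective⇒≤ {f = λ j → label j tt} (label-inj tt tt)
  where open Labelling (no-family⇒labelling (λ _ → ⊤) (λ _ → yes tt) r ¬C)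


-- Leaves and meeting heights

mapTree : ∀ {A B h} → (A → B) → RTree A h → RTree B h
mapTree g (leaf a)   = leaf (g a)
mapTree g (node k f) = node k (mapTree g ∘ f)

-- Meet t a b ℓ: the leaves a and b of t lie in distinct children of a node of height ℓ.
-- This is LeafDist with the distance 2ℓ replaced by ℓ, which makes ℓ easy to compute with.
data Meet {A : Set} : ∀ {h} → RTree A h → A → A → ℕ → Set where
  within : ∀ {h k} {f : Fin (suc k) → RTree A h} (i : Fin (suc k)) {a b ℓ} →
           Meet (f i) a b ℓ → Meet (node k f) a b ℓ
  across : ∀ {h k} {f : Fin (suc k) → RTree A h} (i j : Fin (suc k)) {a b} →
           i ≢ j → a ∈ leaves (f i) → b ∈ leaves (f j) → Meet (node k f) a b (suc h)

module _ {A : Set} where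

  map-concat-tabulate : ∀ {B : Set} {n} (g : A → B) (f : Fin n → List A) →
                        map g (concat (tabulate f)) ≡ concat (tabulate (map g ∘ f))
  map-concat-tabulate g f =
    trans (sym (concat-map (tabulate f))) (cong concat (map-tabulate f (map g)))

  leaves-mapTree : ∀ {B h} (g : A → B) (t : RTree A h) → leaves (mapTree g t) ≡ map g (leaves t)
  leaves-mapTree g (leaf a)   = refl
  leaves-mapTree g (node k f) =
    trans (cong concat (tabulate-cong (leaves-mapTree g ∘ f))) (sym (map-concat-tabulate g (leaves ∘ f)))

  ∈-child : ∀ {h k} (f : Fin (suc k) → RTree A h) j {a} → a ∈ leaves (f j) → a ∈ leaves (node k f)
  ∈-child f j a∈ = ∈-concat⁺′ a∈ (∈-tabulate⁺ {f = leaves ∘ f} j)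

  ∈-node⁻ : ∀ {h k} (f : Fin (suc k) → RTree A h) {a} → a ∈ leaves (node k f) → ∃ λ j → a ∈ leaves (f j)
  ∈-node⁻ f a∈ with ∈-concat⁻′ (tabulate (leaves ∘ f)) a∈
  ... | xs , a∈xs , xs∈ with ∈-tabulate⁻ {f = leaves ∘ f} xs∈
  ... | j , refl = j , a∈xs

  LeafDist⇒Meet : ∀ {h} {t : RTree A h} {a b} ℓ → LeafDist t a b (2 * ℓ) → Meet t a b ℓ
  LeafDist⇒Meet ℓ d = go d refl
    where
    go : ∀ {h} {t : RTree A h} {a b δ} → LeafDist t a b δ → δ ≡ 2 * ℓ → Meet t a b ℓ
    go (down i d) e = within i (go d e)
    go (split {d = h} i j i≢j a∈ b∈) e with *-cancelˡ-≡ (suc h) ℓ 2 e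
    ... | refl = across i j i≢j a∈ b∈

  Meet⇒LeafDist : ∀ {h} {t : RTree A h} {a b ℓ} → Meet t a b ℓ → LeafDist t a b (2 * ℓ)
  Meet⇒LeafDist (within i m)           = down i (Meet⇒LeafDist m)
  Meet⇒LeafDist (across i j i≢j a∈ b∈) = split i j i≢j a∈ b∈

  Meet-leaves : ∀ {h} {t : RTree A h} {a b ℓ} → Meet t a b ℓ → a ∈ leaves t × b ∈ leaves t
  Meet-leaves (within {f = f} i m)           = Product.map (∈-child f i) (∈-child f i) (Meet-leaves m)
  Meet-leaves (across {f = f} i j i≢j a∈ b∈) = ∈-child f i a∈ , ∈-child f j b∈

  Meet-sym : ∀ {h} {t : RTree A h} {a b ℓ} → Meet t a b ℓ → Meet t b a ℓ
  Meet-sym (within i m)           = within i (Meet-sym m)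
  Meet-sym (across i j i≢j a∈ b∈) = across j i (i≢j ∘ sym) b∈ a∈

  Meet-height : ∀ {h} {t : RTree A h} {a b ℓ} → Meet t a b ℓ → ℓ ≤ h
  Meet-height (within i m)       = m≤n⇒m≤1+n (Meet-height m)
  Meet-height (across i j _ _ _) = ≤-refl

Meet-mapTree : ∀ {A B h} (g : A → B) {t : RTree A h} {a′ b′ ℓ} → Meet (mapTree g t) a′ b′ ℓ →
               ∃₂ λ a b → a′ ≡ g a × b′ ≡ g b × Meet t a b ℓ
Meet-mapTree g {node k f} (within i m) with Meet-mapTree g m
... | a , b , refl , refl , m′ = a , b , refl , refl , within i m′
Meet-mapTree g {node k f} (across i j i≢j a∈ b∈)
  with ∈-map⁻ g (subst (_ ∈_) (leaves-mapTree g (f i)) a∈)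
     | ∈-map⁻ g (subst (_ ∈_) (leaves-mapTree g (f j)) b∈)
... | a , a∈′ , refl | b , b∈′ , refl = a , b , refl , refl , across i j i≢j a∈′ b∈′

BottomBounded-mapTree : ∀ {A B : Set} {c h} (g : A → B) (t : RTree A h) →
                        BottomBounded c t → BottomBounded c (mapTree g t)
BottomBounded-mapTree g (leaf a)           _  = tt
BottomBounded-mapTree {c = c} g (node {zero} k f) bb =
  subst (_≤ c) (sym (trans (cong length (leaves-mapTree g (node k f)))
                           (length-map g (leaves (node k f))))) bb
BottomBounded-mapTree g (node {suc h} k f) bb = λ i → BottomBounded-mapTree g (f i) (bb i)

length-leaves-height-1 : ∀ {A : Set} {k} (f : Fin (suc k) → RTree A 0) →
                         length (leaves (node k f)) ≡ suc k
length-leaves-height-1 {k = zero}  f with f zero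
... | leaf a = refl
length-leaves-height-1 {k = suc k} f with f zero | length-leaves-height-1 (f ∘ suc)
... | leaf a | eq = cong suc eq


-- Tree surgery: lift, wrap and merge

tabulate-splitAt : ∀ {B : Set} m {n} (g : Fin m ⊎ Fin n → B) →
                   tabulate (g ∘ splitAt m) ≡ tabulate (g ∘ inj₁) ++ tabulate (g ∘ inj₂)
tabulate-splitAt zero    g = refl
tabulate-splitAt (suc m) g = cong (g (inj₁ zero) ∷_) (tabulate-splitAt m (g ∘ Sum.map₁ suc))

splitAt-injective : ∀ m {n} {i j : Fin (m + n)} → splitAt m i ≡ splitAt m j → i ≡ j
splitAt-injective m {n} {i} {j} e = begin
  i                      ≡⟨ sym (join-splitAt m n i) ⟩
  join m n (splitAt m i) ≡⟨ cong (join m n) e ⟩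
  join m n (splitAt m j) ≡⟨ join-splitAt m n j ⟩
  j                      ∎
  where open ≡-Reasoning

module _ {A : Set} where

  lift : ∀ {h} → RTree A h → RTree A (suc h)
  lift (leaf a)   = node 0 (λ _ → leaf a)
  lift (node k f) = node k (lift ∘ f)

  leaves-lift : ∀ {h} (t : RTree A h) → leaves (lift t) ≡ leaves t
  leaves-lift (leaf a)   = refl
  leaves-lift (node k f) = cong concat (tabulate-cong (leaves-lift ∘ f))

  Meet-lift : ∀ {h} {t : RTree A h} {a b ℓ} → Meet (lift t) a b ℓ → Meet t a b (pred ℓ)
  Meet-lift {t = leaf a}   (within zero ())
  Meet-lift {t = leaf a}   (across zero zero 0≢0 _ _) = ⊥-elim (0≢0 refl)
  Meet-lift {t = node k f} (within i m)               = within i (Meet-lift m)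
  Meet-lift {t = node k f} (across i j i≢j a∈ b∈)     =
    across i j i≢j (subst (_ ∈_) (leaves-lift (f i)) a∈) (subst (_ ∈_) (leaves-lift (f j)) b∈)

  BottomBounded-lift : ∀ {c h} → 1 ≤ c → (t : RTree A h) → BottomBounded c (lift t)
  BottomBounded-lift 1≤c (leaf a)   = 1≤c
  BottomBounded-lift 1≤c (node k f) = λ i → BottomBounded-lift 1≤c (f i)

  wrap : ∀ {h} → RTree A h → RTree A (suc h)
  wrap t = node 0 (λ _ → t)

  leaves-wrap : ∀ {h} (t : RTree A h) → leaves (wrap t) ≡ leaves t
  leaves-wrap t = ++-identityʳ (leaves t)

  Meet-wrap : ∀ {h} {t : RTree A h} {a b ℓ} → Meet (wrap t) a b ℓ → Meet t a b ℓ
  Meet-wrap (within zero m)            = m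
  Meet-wrap (across zero zero 0≢0 _ _) = ⊥-elim (0≢0 refl)

  infixr 5 _⊕_
  _⊕_ : ∀ {h} → RTree A (suc h) → RTree A (suc h) → RTree A (suc h)
  node k f ⊕ node k′ g = node (k + suc k′) (λ i → [ f , g ]′ (splitAt (suc k) i))

  leaves-⊕ : ∀ {h} (x y : RTree A (suc h)) → leaves (x ⊕ y) ≡ leaves x ++ leaves y
  leaves-⊕ (node k f) (node k′ g) = begin
    concat (tabulate (leaves ∘ [ f , g ]′ ∘ splitAt (suc k)))
      ≡⟨ cong concat (tabulate-splitAt (suc k) (leaves ∘ [ f , g ]′)) ⟩
    concat (tabulate (leaves ∘ f) ++ tabulate (leaves ∘ g))
      ≡⟨ sym (concat-++ (tabulate (leaves ∘ f)) (tabulate (leaves ∘ g))) ⟩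
    leaves (node k f) ++ leaves (node k′ g) ∎
    where open ≡-Reasoning

  Straddles : ∀ {h} → RTree A h → RTree A h → A → A → Set
  Straddles x y a b = (a ∈ leaves x × b ∈ leaves y) ⊎ (b ∈ leaves x × a ∈ leaves y)

  Meet-⊕ : ∀ {h} (x y : RTree A (suc h)) {a b ℓ} → Meet (x ⊕ y) a b ℓ →
           Meet x a b ℓ ⊎ Meet y a b ℓ ⊎ (ℓ ≡ suc h × Straddles x y a b)
  Meet-⊕ (node k f) (node k′ g) (within i m) with splitAt (suc k) i
  ... | inj₁ i′ = inj₁ (within i′ m)
  ... | inj₂ i′ = inj₂ (inj₁ (within i′ m))
  Meet-⊕ (node k f) (node k′ g) (across i j i≢j a∈ b∈)
    with splitAt (suc k) i in eqi | splitAt (suc k) j in eqj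
  ... | inj₁ i′ | inj₁ j′ = inj₁ (across i′ j′ (i≢j ∘ same-part ∘ cong inj₁) a∈ b∈)
    where same-part = λ e → splitAt-injective (suc k) (trans eqi (trans e (sym eqj)))
  ... | inj₂ i′ | inj₂ j′ = inj₂ (inj₁ (across i′ j′ (i≢j ∘ same-part ∘ cong inj₂) a∈ b∈))
    where same-part = λ e → splitAt-injective (suc k) (trans eqi (trans e (sym eqj)))
  ... | inj₁ i′ | inj₂ j′ = inj₂ (inj₂ (refl , inj₁ (∈-child f i′ a∈ , ∈-child g j′ b∈)))
  ... | inj₂ i′ | inj₁ j′ = inj₂ (inj₂ (refl , inj₂ (∈-child f j′ b∈ , ∈-child g i′ a∈)))

  BottomBounded-⊕ : ∀ {c h} (x y : RTree A (suc (suc h))) →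
                    BottomBounded c x → BottomBounded c y → BottomBounded c (x ⊕ y)
  BottomBounded-⊕ (node k f) (node k′ g) bx by i with splitAt (suc k) i
  ... | inj₁ i′ = bx i′
  ... | inj₂ i′ = by i′

  merge : ∀ {h} k → (Fin (suc k) → RTree A (suc h)) → RTree A (suc h)
  merge zero    f = f zero
  merge (suc k) f = f zero ⊕ merge k (f ∘ suc)

  leaves-merge : ∀ {h} k (f : Fin (suc k) → RTree A (suc h)) → leaves (merge k f) ≡ leaves (node k f)
  leaves-merge zero    f = sym (++-identityʳ (leaves (f zero)))
  leaves-merge (suc k) f =
    trans (leaves-⊕ (f zero) (merge k (f ∘ suc))) (cong (leaves (f zero) ++_) (leaves-merge k (f ∘ suc)))

  Separated : ∀ {h k} → (Fin (suc k) → RTree A h) → A → A → Set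
  Separated f a b = ∃₂ λ i j → i ≢ j × a ∈ leaves (f i) × b ∈ leaves (f j)

  Separated-sym : ∀ {h k} {f : Fin (suc k) → RTree A h} {a b} → Separated f a b → Separated f b a
  Separated-sym (i , j , i≢j , a∈ , b∈) = j , i , i≢j ∘ sym , b∈ , a∈

  Separated-suc : ∀ {h k} {f : Fin (suc (suc k)) → RTree A h} {a b} →
                  Separated (f ∘ suc) a b → Separated f a b
  Separated-suc (i , j , i≢j , a∈ , b∈) = suc i , suc j , i≢j ∘ suc-injective , a∈ , b∈

  separated-from-head : ∀ {h k} (f : Fin (suc (suc k)) → RTree A (suc h)) {a b} →
                        a ∈ leaves (f zero) → b ∈ leaves (merge k (f ∘ suc)) → Separated f a b
  separated-from-head {k = k} f {b = b} a∈ b∈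
    with ∈-node⁻ (f ∘ suc) (subst (b ∈_) (leaves-merge k (f ∘ suc)) b∈)
  ... | j , b∈′ = zero , suc j , (λ ()) , a∈ , b∈′

  Meet-merge : ∀ {h} k (f : Fin (suc k) → RTree A (suc h)) {a b ℓ} → Meet (merge k f) a b ℓ →
               (∃ λ j → Meet (f j) a b ℓ) ⊎ (ℓ ≡ suc h × Separated f a b)
  Meet-merge zero    f m = inj₁ (zero , m)
  Meet-merge (suc k) f m with Meet-⊕ (f zero) (merge k (f ∘ suc)) m
  ... | inj₁ m′                          = inj₁ (zero , m′)
  ... | inj₂ (inj₁ m′)                   =
    Sum.map (Product.map suc id) (Product.map₂ (Separated-suc {f = f})) (Meet-merge k (f ∘ suc) m′)
  ... | inj₂ (inj₂ (e , inj₁ (a∈ , b∈))) = inj₂ (e , separated-from-head f a∈ b∈)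
  ... | inj₂ (inj₂ (e , inj₂ (b∈ , a∈))) = inj₂ (e , Separated-sym {f = f} (separated-from-head f b∈ a∈))

  BottomBounded-merge : ∀ {c h} k (f : Fin (suc k) → RTree A (suc (suc h))) →
                        (∀ j → BottomBounded c (f j)) → BottomBounded c (merge k f)
  BottomBounded-merge zero    f bb = bb zero
  BottomBounded-merge (suc k) f bb =
    BottomBounded-⊕ (f zero) (merge k (f ∘ suc)) (bb zero) (BottomBounded-merge k (f ∘ suc) (bb ∘ suc))


-- Tags and the recovery of meeting heights

-- Tags at height h + 2 are either big (the label in Fin r of a lifted big child) or small (a
-- tag at height h + 1 coming from a reshaped small child).  Trees of height ≤ 1 use one tag.
module Tags (r : ℕ) where

  tagCount : ℕ → ℕ
  tagCount zero          = 1
  tagCount (suc zero)    = 1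
  tagCount (suc (suc h)) = r + tagCount (suc h)

  Tag : ℕ → Set
  Tag h = Fin (tagCount h)

  big : ∀ {h} → Fin r → Tag (suc (suc h))
  big {h} i = i ↑ˡ tagCount (suc h)

  small : ∀ {h} → Tag (suc h) → Tag (suc (suc h))
  small x = r ↑ʳ x

  -- Leaves of the same lifted child met one level lower before lifting.
  bigPair : Fin r → Fin r → ℕ → ℕ
  bigPair i j ℓ with i ≟ᶠ j
  ... | yes _ = pred ℓ
  ... | no  _ = ℓ

  -- oldHeight h x y ℓ: the height at which leaves tagged x and y met in the original tree of
  -- height h, given that they meet at height ℓ in the reshaped one.
  mutual
    oldHeight : ∀ h → Tag h → Tag h → ℕ → ℕ
    oldHeight zero          _ _ ℓ = ℓ
    oldHeight (suc zero)    _ _ ℓ = ℓ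
    oldHeight (suc (suc h)) x y ℓ = fromParts (suc h) (splitAt r x) (splitAt r y) ℓ

    fromParts : ∀ h → Fin r ⊎ Tag h → Fin r ⊎ Tag h → ℕ → ℕ
    fromParts h (inj₁ i) (inj₁ j) ℓ = bigPair i j ℓ
    fromParts h (inj₂ x) (inj₂ y) ℓ = smallPair h x y ℓ
    fromParts h (inj₁ _) (inj₂ _) ℓ = ℓ
    fromParts h (inj₂ _) (inj₁ _) ℓ = ℓ

    -- Leaves of the same small child meet below the root; at the root they are separated.
    smallPair : ∀ h → Tag h → Tag h → ℕ → ℕ
    smallPair h x y ℓ with ℓ ≟ suc h
    ... | yes _ = ℓ
    ... | no  _ = oldHeight h x y ℓ

  module _ {h : ℕ} where

    oldHeight-big-same : ∀ i ℓ → oldHeight (suc (suc h)) (big {h} i) (big {h} i) ℓ ≡ pred ℓ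
    oldHeight-big-same i ℓ rewrite splitAt-↑ˡ r i (tagCount (suc h)) with i ≟ᶠ i
    ... | yes _   = refl
    ... | no  i≢i = ⊥-elim (i≢i refl)

    oldHeight-big-diff : ∀ {i j} ℓ → i ≢ j → oldHeight (suc (suc h)) (big {h} i) (big {h} j) ℓ ≡ ℓ
    oldHeight-big-diff {i} {j} ℓ i≢j
      rewrite splitAt-↑ˡ r i (tagCount (suc h)) | splitAt-↑ˡ r j (tagCount (suc h)) with i ≟ᶠ j
    ... | yes i≡j = ⊥-elim (i≢j i≡j)
    ... | no  _   = refl

    oldHeight-big-small : ∀ i y ℓ → oldHeight (suc (suc h)) (big {h} i) (small {h} y) ℓ ≡ ℓ
    oldHeight-big-small i y ℓ
      rewrite splitAt-↑ˡ r i (tagCount (suc h)) | splitAt-↑ʳ r (tagCount (suc h)) y = refl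

    oldHeight-small-big : ∀ x j ℓ → oldHeight (suc (suc h)) (small {h} x) (big {h} j) ℓ ≡ ℓ
    oldHeight-small-big x j ℓ
      rewrite splitAt-↑ˡ r j (tagCount (suc h)) | splitAt-↑ʳ r (tagCount (suc h)) x = refl

    oldHeight-small-top : ∀ x y →
                          oldHeight (suc (suc h)) (small {h} x) (small {h} y) (suc (suc h)) ≡ suc (suc h)
    oldHeight-small-top x y
      rewrite splitAt-↑ʳ r (tagCount (suc h)) x | splitAt-↑ʳ r (tagCount (suc h)) y
      with suc (suc h) ≟ suc (suc h)
    ... | yes _   = refl
    ... | no  neq = ⊥-elim (neq refl)

    oldHeight-small-below : ∀ x y ℓ → ℓ ≤ suc h →
                            oldHeight (suc (suc h)) (small {h} x) (small {h} y) ℓ ≡ oldHeight (suc h) x y ℓ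
    oldHeight-small-below x y ℓ ℓ≤
      rewrite splitAt-↑ʳ r (tagCount (suc h)) x | splitAt-↑ʳ r (tagCount (suc h)) y
      with ℓ ≟ suc (suc h)
    ... | yes refl = ⊥-elim (1+n≰n ℓ≤)
    ... | no  _    = refl


-- Reshapings

record Reshaping {A B : Set} (c : ℕ) (recover : B → B → ℕ → ℕ) {h h′}
                 (t : RTree A h) (t′ : RTree (A × B) h′) : Set where
  field
    same-leaves : map proj₁ (leaves t′) ↭ leaves t
    meets       : ∀ {a x b y ℓ} → Meet t′ (a , x) (b , y) ℓ → Meet t a b (recover x y ℓ)
    bounded     : BottomBounded c t′
open Reshaping

concat-tabulate-↭ : ∀ {B : Set} {n} (g g′ : Fin n → List B) → (∀ i → g i ↭ g′ i) →
                    concat (tabulate g) ↭ concat (tabulate g′)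
concat-tabulate-↭ {n = zero}  g g′ g↭g′ = ↭-refl
concat-tabulate-↭ {n = suc n} g g′ g↭g′ =
  ++⁺ (g↭g′ zero) (concat-tabulate-↭ (g ∘ suc) (g′ ∘ suc) (g↭g′ ∘ suc))

tag : ∀ {A B : Set} {h} → B → RTree A h → RTree (A × B) h
tag z = mapTree (_, z)

retag : ∀ {A B B′ : Set} {h} → (B → B′) → RTree (A × B) h → RTree (A × B′) h
retag e = mapTree (Product.map₂ e)

module _ {A B : Set} where

  untag-tag : ∀ {h} (z : B) (t : RTree A h) → map proj₁ (leaves (tag z t)) ≡ leaves t
  untag-tag z t = begin
    map proj₁ (leaves (tag z t))      ≡⟨ cong (map proj₁) (leaves-mapTree (_, z) t) ⟩
    map proj₁ (map (_, z) (leaves t)) ≡⟨ sym (map-∘ (leaves t)) ⟩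
    map id (leaves t)                 ≡⟨ map-id (leaves t) ⟩
    leaves t                          ∎
    where open ≡-Reasoning

  ∈-tag : ∀ {h} {z : B} (t : RTree A h) {a x} → (a , x) ∈ leaves (tag z t) → x ≡ z
  ∈-tag {z = z} t a∈ with ∈-map⁻ (_, z) (subst (_ ∈_) (leaves-mapTree (_, z) t) a∈)
  ... | _ , _ , refl = refl

  untag-retag : ∀ {B′ : Set} {h} (e : B′ → B) (t : RTree (A × B′) h) →
                map proj₁ (leaves (retag e t)) ≡ map proj₁ (leaves t)
  untag-retag e t = trans (cong (map proj₁) (leaves-mapTree (Product.map₂ e) t)) (sym (map-∘ (leaves t)))

  ∈-retag : ∀ {B′ : Set} {h} (e : B′ → B) (t : RTree (A × B′) h) {a x} →
            (a , x) ∈ leaves (retag e t) → ∃ λ x₀ → x ≡ e x₀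
  ∈-retag e t a∈ with ∈-map⁻ (Product.map₂ e) (subst (_ ∈_) (leaves-mapTree (Product.map₂ e) t) a∈)
  ... | (_ , x₀) , _ , refl = x₀ , refl

  module _ {c : ℕ} {recover : B → B → ℕ → ℕ} where

    tag-reshaping : ∀ {h} (z : B) (t : RTree A h) → (∀ ℓ → recover z z ℓ ≡ ℓ) →
                    BottomBounded c t → Reshaping c recover t (tag z t)
    tag-reshaping z t recover-id bb = record
      { same-leaves = ↭-reflexive (untag-tag z t)
      ; meets       = meets′
      ; bounded     = BottomBounded-mapTree (_, z) t bb }
      where
      meets′ : ∀ {a x b y ℓ} → Meet (tag z t) (a , x) (b , y) ℓ → Meet t a b (recover x y ℓ)
      meets′ m with Meet-mapTree (_, z) m
      ... | a , b , refl , refl , m′ = subst (Meet t a b) (sym (recover-id _)) m′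

    lift-reshaping : ∀ {h} (z : B) (t : RTree A h) → (∀ ℓ → recover z z ℓ ≡ pred ℓ) →
                     1 ≤ c → Reshaping c recover t (tag z (lift t))
    lift-reshaping z t recover-pred 1≤c = record
      { same-leaves = ↭-reflexive (trans (untag-tag z (lift t)) (leaves-lift t))
      ; meets       = meets′
      ; bounded     = BottomBounded-mapTree (_, z) (lift t) (BottomBounded-lift 1≤c t) }
      where
      meets′ : ∀ {a x b y ℓ} → Meet (tag z (lift t)) (a , x) (b , y) ℓ → Meet t a b (recover x y ℓ)
      meets′ m with Meet-mapTree (_, z) m
      ... | a , b , refl , refl , m′ = subst (Meet t a b) (sym (recover-pred _)) (Meet-lift m′)

    wrap-reshaping : ∀ {B′ : Set} {recover′ : B′ → B′ → ℕ → ℕ} {h h′} {t : RTree A h}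
                     {t′ : RTree (A × B′) (suc h′)} (e : B′ → B) →
                     (∀ x y ℓ → ℓ ≤ suc h′ → recover (e x) (e y) ℓ ≡ recover′ x y ℓ) →
                     Reshaping c recover′ t t′ → Reshaping c recover t (wrap (retag e t′))
    wrap-reshaping {t = t} {t′} e recover-e R = record
      { same-leaves = ↭-trans (↭-reflexive (trans (cong (map proj₁) (leaves-wrap (retag e t′)))
                                                  (untag-retag e t′)))
                              (same-leaves R)
      ; meets       = meets′
      ; bounded     = λ _ → BottomBounded-mapTree (Product.map₂ e) t′ (bounded R) }
      where
      meets′ : ∀ {a x b y ℓ} → Meet (wrap (retag e t′)) (a , x) (b , y) ℓ → Meet t a b (recover x y ℓ)
      meets′ m with Meet-mapTree (Product.map₂ e) (Meet-wrap m)
      ... | (a , x) , (b , y) , refl , refl , m′ =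
        subst (Meet t a b) (sym (recover-e x y _ (Meet-height m′))) (meets R m′)

    record Piece {h} (t : RTree A (suc h)) : Set₁ where
      field
        tree      : RTree (A × B) (suc (suc h))
        reshaping : Reshaping c recover t tree
        Class     : B → Set
        classify  : ∀ {a x} → (a , x) ∈ leaves tree → Class x

    merge-reshaping : ∀ {h k} {f : Fin (suc k) → RTree A (suc h)} (P : ∀ j → Piece (f j)) →
                      (∀ {i j x y} → i ≢ j → Piece.Class (P i) x → Piece.Class (P j) y →
                         recover x y (suc (suc h)) ≡ suc (suc h)) →
                      Reshaping c recover (node k f) (merge k (Piece.tree ∘ P))
    merge-reshaping {h} {k} {f} P apart = record
      { same-leaves = same
      ; meets       = meets′
      ; bounded     = BottomBounded-merge k s (bounded ∘ R) }
      where
      s = Piece.tree ∘ P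
      R = Piece.reshaping ∘ P
      same : map proj₁ (leaves (merge k s)) ↭ leaves (node k f)
      same = begin
        map proj₁ (leaves (merge k s))             ≡⟨ cong (map proj₁) (leaves-merge k s) ⟩
        map proj₁ (concat (tabulate (leaves ∘ s))) ≡⟨ map-concat-tabulate proj₁ (leaves ∘ s) ⟩
        concat (tabulate (map proj₁ ∘ leaves ∘ s)) ↭⟨ concat-tabulate-↭ _ _ (same-leaves ∘ R) ⟩
        concat (tabulate (leaves ∘ f))             ∎
        where open PermutationReasoning
      owner : ∀ i {a x} → (a , x) ∈ leaves (s i) → a ∈ leaves (f i)
      owner i a∈ = ∈-resp-↭ (same-leaves (R i)) (∈-map⁺ proj₁ a∈)
      meets′ : ∀ {a x b y ℓ} → Meet (merge k s) (a , x) (b , y) ℓ → Meet (node k f) a b (recover x y ℓ)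
      meets′ m with Meet-merge k s m
      ... | inj₁ (j , m′) = within j (meets (R j) m′)
      ... | inj₂ (refl , i , j , i≢j , a∈ , b∈) =
        subst (Meet (node k f) _ _) (sym (apart i≢j (Piece.classify (P i) a∈) (Piece.classify (P j) b∈)))
              (across i j i≢j (owner i a∈) (owner j b∈))

module Reshape {A : Set} (r : ℕ) where
  open Tags r

  Reshaped : ∀ {h} → RTree A h → Set
  Reshaped {h} t = Σ (RTree (A × Tag h) h) (Reshaping (suc r) (oldHeight h) t)

  -- Height 1: the node has fewer than r children, so tagging by a single tag suffices.
  base : ∀ k (f : Fin (suc k) → RTree A 0) → ¬ ContainsComplete (node k f) 1 r → Reshaped (node k f)
  base k f ¬C = tag zero (node k f) , tag-reshaping zero (node k f) (λ _ → refl) few-leaves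
    where
    few-leaves : length (leaves (node k f)) ≤ suc r
    few-leaves = subst (_≤ suc r) (sym (length-leaves-height-1 f)) (m≤n⇒m≤1+n (few-children f ¬C))

  module Step {h k} (f : Fin (suc k) → RTree A (suc h))
              (¬C : ¬ ContainsComplete (node k f) (suc (suc h)) r)
              (reshape-child : ∀ j → ¬ ContainsComplete (f j) (suc h) r → Reshaped (f j)) where

    IsBig : Fin (suc k) → Set
    IsBig j = ContainsComplete (f j) (suc h) r

    big? : ∀ j → Dec (IsBig j)
    big? j = contains? (f j) (suc h) r

    -- Since the node avoids the complete tree, its big children carry distinct labels in Fin r.
    open Labelling (no-family⇒labelling IsBig big? r ¬C)

    piece : ∀ j → Dec (IsBig j) → Piece {c = suc r} {recover = oldHeight (suc (suc h))} (f j)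
    piece j (yes big-j) = record
      { tree      = tag (big {h} (label j big-j)) (lift (f j))
      ; reshaping = lift-reshaping _ (f j) (oldHeight-big-same _) (s≤s z≤n)
      ; Class     = _≡ big {h} (label j big-j)
      ; classify  = ∈-tag (lift (f j)) }
    piece j (no small-j) = record
      { tree      = wrap (retag (small {h}) t′)
      ; reshaping = wrap-reshaping (small {h}) oldHeight-small-below R
      ; Class     = λ x → ∃ λ x₀ → x ≡ small {h} x₀
      ; classify  = ∈-retag (small {h}) t′ ∘ subst (_ ∈_) (leaves-wrap (retag (small {h}) t′)) }
      where
      t′ = proj₁ (reshape-child j small-j)
      R  = proj₂ (reshape-child j small-j)

    pieces : ∀ j → Piece (f j)
    pieces j = piece j (big? j)

    apart : ∀ {i j x y} → i ≢ j → Piece.Class (pieces i) x → Piece.Class (pieces j) y →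
            oldHeight (suc (suc h)) x y (suc (suc h)) ≡ suc (suc h)
    apart {i} {j} i≢j with big? i | big? j
    ... | yes big-i | yes big-j = λ { refl refl → oldHeight-big-diff _ (i≢j ∘ label-inj big-i big-j) }
    ... | yes _     | no  _     = λ { refl (y₀ , refl) → oldHeight-big-small _ y₀ _ }
    ... | no  _     | yes _     = λ { (x₀ , refl) refl → oldHeight-small-big x₀ _ _ }
    ... | no  _     | no  _     = λ { (x₀ , refl) (y₀ , refl) → oldHeight-small-top x₀ y₀ }

    reshaped : Reshaped (node k f)
    reshaped = merge k (Piece.tree ∘ pieces) , merge-reshaping pieces apart

  -- Structural induction; a leaf always contains the complete tree of height 0.
  reshape : ∀ {h} (t : RTree A h) → ¬ ContainsComplete t h r → Reshaped t
  reshape (leaf a)           ¬C = ⊥-elim (¬C tt)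
  reshape (node {zero}  k f) ¬C = base k f ¬C
  reshape (node {suc h} k f) ¬C = Step.reshaped f ¬C (λ j → reshape (f j))


-- The copied tree-model

first-determines-second : ∀ {A B : Set} {L : List (A × B)} → Unique (map proj₁ L) →
                          ∀ {a x y} → (a , x) ∈ L → (a , y) ∈ L → x ≡ y
first-determines-second _            (here refl) (here refl) = refl
first-determines-second (a∉ ∷ _)     (here refl) (there a∈)  = ⊥-elim (All-lookup a∉ (∈-map⁺ proj₁ a∈) refl)
first-determines-second (a∉ ∷ _)     (there a∈)  (here refl) = ⊥-elim (All-lookup a∉ (∈-map⁺ proj₁ a∈) refl)
first-determines-second (_ ∷ unique) (there a∈)  (there a∈′) = first-determines-second unique a∈ a∈′

module CopiedModel {d m r : ℕ} {G : Graph} (M : TreeModel G m (suc d))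
                   (¬C : ¬ ContainsComplete (tree M) (suc d) r) where
  open Tags r
  open Reshape {Fin (n G)} r

  t′ : RTree (Fin (n G) × Tag (suc d)) (suc d)
  t′ = proj₁ (reshape (tree M) ¬C)

  R : Reshaping (suc r) (oldHeight (suc d)) (tree M) t′
  R = proj₂ (reshape (tree M) ¬C)

  vertices : map proj₁ (leaves t′) ↭ allFin (n G)
  vertices = ↭-trans (same-leaves R) (leavesOK M)

  -- Each vertex is a leaf of t′ exactly once, hence carries a well-defined tag.
  distinct : Unique (map proj₁ (leaves t′))
  distinct = SetoidPermutation.Unique-resp-↭ (setoid _) (↭⇒↭ₛ (↭-sym vertices)) (allFin⁺ (n G))

  tagged : ∀ u → ∃ λ x → (u , x) ∈ leaves t′
  tagged u with ∈-map⁻ proj₁ (∈-resp-↭ (↭-sym vertices) (∈-allFin u))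
  ... | (_ , x) , u∈ , refl = x , u∈

  tagOf : Fin (n G) → Tag (suc d)
  tagOf u = proj₁ (tagged u)

  tagOf-correct : ∀ {u x} → (u , x) ∈ leaves t′ → tagOf u ≡ x
  tagOf-correct u∈ = first-determines-second distinct (proj₂ (tagged _)) u∈

  colour : Fin (n G) → Fin (m * tagCount (suc d))
  colour u = combine (col M u) (tagOf u)

  -- The adjacency of the new colours, evaluated at the original height; symmetrised with ∧,
  -- since the two orders agree on edges of G anyway.
  related : Fin m × Tag (suc d) → Fin m × Tag (suc d) → ℕ → Bool
  related (i , x) (j , y) ℓ = S M i j (oldHeight (suc d) x y ℓ) ∧ S M j i (oldHeight (suc d) y x ℓ)

  S′ : Fin (m * tagCount (suc d)) → Fin (m * tagCount (suc d)) → ℕ → Bool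
  S′ c c′ ℓ = related (remQuot (tagCount (suc d)) c) (remQuot (tagCount (suc d)) c′) ℓ

  S′-sym : ∀ c c′ ℓ → S′ c c′ ℓ ≡ S′ c′ c ℓ
  S′-sym c c′ ℓ = ∧-comm (S M _ _ _) (S M _ _ _)

  S′-colour : ∀ u v ℓ → S′ (colour u) (colour v) ℓ ≡ related (col M u , tagOf u) (col M v , tagOf v) ℓ
  S′-colour u v ℓ = cong₂ (λ p q → related p q ℓ) (remQuot-combine (col M u) (tagOf u))
                                                    (remQuot-combine (col M v) (tagOf v))

  -- Edges of G are read off correctly: meeting heights in t′ translate back to t through
  -- oldHeight, and the tags of u and v are those of their leaves.
  edges′ : ∀ u v ℓ → u ≢ v → LeafDist (mapTree proj₁ t′) u v (2 * ℓ) →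
           adj G u v ≡ S′ (colour u) (colour v) ℓ
  edges′ u v ℓ u≢v dist with Meet-mapTree proj₁ (LeafDist⇒Meet ℓ dist)
  ... | (u , x) , (v , y) , refl , refl , meet = begin
    adj G u v                                         ≡⟨ sym (∧-idem (adj G u v)) ⟩
    adj G u v ∧ adj G u v                             ≡⟨ cong (adj G u v ∧_) (Graph.sym G u v) ⟩
    adj G u v ∧ adj G v u                             ≡⟨ cong₂ _∧_ uv vu ⟩
    related (col M u , x) (col M v , y) ℓ             ≡⟨ cong₂ (λ x y → related (col M u , x) (col M v , y) ℓ)
                                                               (sym (tagOf-correct u∈)) (sym (tagOf-correct v∈)) ⟩
    related (col M u , tagOf u) (col M v , tagOf v) ℓ ≡⟨ sym (S′-colour u v ℓ) ⟩
    S′ (colour u) (colour v) ℓ                        ∎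
    where
    open ≡-Reasoning
    u∈ = proj₁ (Meet-leaves meet)
    v∈ = proj₂ (Meet-leaves meet)
    uv = edges M u v _ u≢v (Meet⇒LeafDist (meets R meet))
    vu = edges M v u _ (u≢v ∘ sym) (Meet⇒LeafDist (meets R (Meet-sym meet)))

  copied-model : InTMC d (m * tagCount (suc d)) (suc r) G
  copied-model =
    record { tree     = mapTree proj₁ t′
           ; leavesOK = ↭-trans (↭-reflexive (leaves-mapTree proj₁ t′)) vertices
           ; col      = colour
           ; S        = S′
           ; S-sym    = S′-sym
           ; edges    = edges′ }
    , BottomBounded-mapTree {c = suc r} proj₁ t′ (bounded R)


-- For d = 0 the hypothesis is void: every tree contains the complete tree of height 0.
-- Otherwise the copied models use m · tagCount r d colours and at most r + 1 copies.
lemma4p10 : (𝒢 : GraphClass) → BoundedShrubDepth 𝒢 →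
    (d m r : ℕ) →
    (∀ G → 𝒢 G → Σ (TreeModel G m d) λ M → ¬ ContainsComplete (tree M) d r) →
    CopyingShrubDepth≤ 𝒢 (d ∸ 1)
lemma4p10 𝒢 _ zero    m r models = 0 , 0 , λ G G∈𝒢 → ⊥-elim (proj₂ (models G G∈𝒢) tt)
lemma4p10 𝒢 _ (suc d) m r models = m * Tags.tagCount r (suc d) , suc r ,
  λ G G∈𝒢 → CopiedModel.copied-model (proj₁ (models G G∈𝒢)) (proj₂ (models G G∈𝒢))
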